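{- For any connected finite simple graph $G$ of order $n \ge 2$, $\gamma(M(G\circ P_2)) = n + \gamma(M(G))$.
   Context: The $2$-corona $G\circ P_2$ is the graph of order $3|V(G)|$ obtained from $G$ by attaching to each vertex $v$ of $G$ a path of length $2$ (i.e. adding new vertices $a_v,b_v$ and edges $va_v$, $a_vb_v$), these paths being pairwise vertex-disjoint. For a finite simple graph $H$, the middle graph $M(H)$ is the graph with vertex set $V(H)\cup E(H)$ in which two elements $x,y$ are adjacent if and only if either (1) $x,y\in E(H)$ and the edges $x,y$ share a common endpoint in $H$, or (2) $x\in V(H)$, $y\in E(H)$ and $x$ is an endpoint of $y$ (or vice versa). A dominating set of a graph $H$ is a set $S\subseteq V(H)$ such that every vertex of $H$ is in $S$ or adjacent to a vertex of $S$; the domination number $\gamma(H)$ is the minimum cardinality of a dominating set of $H$. -}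

module Defs where

open import Data.Nat using (ℕ; zero; suc; _*_)
open import Data.Bool using (Bool; true; false; T; _∧_; _∨_)
open import Data.Fin using (Fin; zero; suc; _<_; remQuot)
open import Data.Fin.Properties using (_≟_)
open import Data.Product using (Σ; Σ-syntax; ∃; ∃-syntax; _×_; _,_; proj₁; proj₂)
open import Data.Sum using (_⊎_; inj₁; inj₂)
open import Data.List using (List; length)
open import Data.List.Membership.Propositional using (_∈_)
open import Data.List.Relation.Unary.Any using (Any)
open import Data.List.Relation.Unary.Unique.Propositional using (Unique)
open import Relation.Binary.PropositionalEquality using (_≡_)
open import Relation.Nullary using (does)

record SimpleGraph (n : ℕ) : Set where
  field
    adj   : Fin n → Fin n → Bool
    sym   : ∀ u v → adj u v ≡ adj v u
    irrefl : ∀ v → adj v v ≡ false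
open SimpleGraph public

Adj : ∀ {n} → SimpleGraph n → Fin n → Fin n → Set
Adj G u v = T (adj G u v)

data Walk {n} (G : SimpleGraph n) : Fin n → Fin n → Set where
  nil  : ∀ {v} → Walk G v v
  cons : ∀ {u v w} → Adj G u v → Walk G v w → Walk G u w

Connected : ∀ {n} → SimpleGraph n → Set
Connected G = ∀ u v → Walk G u v

record Graph : Set₁ where
  field
    V     : Set
    _~_   : V → V → Set
open Graph public

Dominating : (H : Graph) → List (V H) → Set
Dominating H S = ∀ x → x ∈ S ⊎ Any (λ y → _~_ H x y) S

IsDominationNumber : (H : Graph) → ℕ → Set
IsDominationNumber H k =
  (Σ[ S ∈ List (V H) ] Unique S × Dominating H S × length S ≡ k)
  × (∀ (S : List (V H)) → Unique S → Dominating H S → k Data.Nat.≤ length S)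

-- Middle graph M(G).  Edges of G are represented canonically as pairs
-- (u , v) with u < v and u adjacent to v.

Edge : ∀ {n} → SimpleGraph n → Set
Edge {n} G = Σ[ u ∈ Fin n ] Σ[ v ∈ Fin n ] (u < v × Adj G u v)

Incident : ∀ {n} {G : SimpleGraph n} → Fin n → Edge G → Set
Incident w (u , v , _) = w ≡ u ⊎ w ≡ v

ShareEnd : ∀ {n} {G : SimpleGraph n} → Edge G → Edge G → Set
ShareEnd {G = G} e f = (e ≡ f → Data.Empty.⊥) × Σ[ w ∈ _ ] (Incident {G = G} w e × Incident {G = G} w f)
  where import Data.Empty

MiddleAdj : ∀ {n} (G : SimpleGraph n) → Fin n ⊎ Edge G → Fin n ⊎ Edge G → Set
MiddleAdj G (inj₁ x) (inj₁ y) = Data.Empty.⊥ where import Data.Empty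
MiddleAdj G (inj₁ x) (inj₂ e) = Incident {G = G} x e
MiddleAdj G (inj₂ e) (inj₁ y) = Incident {G = G} y e
MiddleAdj G (inj₂ e) (inj₂ f) = ShareEnd {G = G} e f

M : ∀ {n} → SimpleGraph n → Graph
M {n} G = record { V = Fin n ⊎ Edge G ; _~_ = MiddleAdj G }

-- Vertex i decodes via remQuot to
-- (v , t) with v : Fin n, t : Fin 3; t = 0 is v itself, t = 1 is a_v,
-- t = 2 is b_v.

private
  eqb : ∀ {m} → Fin m → Fin m → Bool
  eqb x y = does (x ≟ y)

  cadj : ∀ {n} → SimpleGraph n → Fin n × Fin 3 → Fin n × Fin 3 → Bool
  cadj G (v , zero)           (w , zero)           = adj G v w
  cadj G (v , zero)           (w , suc zero)       = eqb v w
  cadj G (v , suc zero)       (w , zero)           = eqb v w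
  cadj G (v , suc zero)       (w , suc (suc zero)) = eqb v w
  cadj G (v , suc (suc zero)) (w , suc zero)       = eqb v w
  cadj G _ _ = false

coronaAdj : ∀ {n} → SimpleGraph n → Fin (n * 3) → Fin (n * 3) → Bool
coronaAdj {n} G i j = cadj G (remQuot {n} 3 i) (remQuot {n} 3 j)

private
  eqb-sym : ∀ {m} (x y : Fin m) → eqb x y ≡ eqb y x
  eqb-sym x y with x ≟ y | y ≟ x
  ... | Relation.Nullary.yes _ | Relation.Nullary.yes _ = Relation.Binary.PropositionalEquality.refl
  ... | Relation.Nullary.no _  | Relation.Nullary.no _  = Relation.Binary.PropositionalEquality.refl
  ... | Relation.Nullary.yes p | Relation.Nullary.no q  = Data.Empty.⊥-elim (q (Relation.Binary.PropositionalEquality.sym p))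
    where import Data.Empty
  ... | Relation.Nullary.no p  | Relation.Nullary.yes q = Data.Empty.⊥-elim (p (Relation.Binary.PropositionalEquality.sym q))
    where import Data.Empty

  cadj-sym : ∀ {n} (G : SimpleGraph n) x y → cadj G x y ≡ cadj G y x
  cadj-sym G (v , zero)           (w , zero)           = sym G v w
  cadj-sym G (v , zero)           (w , suc zero)       = eqb-sym v w
  cadj-sym G (v , zero)           (w , suc (suc zero)) = Relation.Binary.PropositionalEquality.refl
  cadj-sym G (v , suc zero)       (w , zero)           = eqb-sym v w
  cadj-sym G (v , suc zero)       (w , suc zero)       = Relation.Binary.PropositionalEquality.refl
  cadj-sym G (v , suc zero)       (w , suc (suc zero)) = eqb-sym v w
  cadj-sym G (v , suc (suc zero)) (w , zero)           = Relation.Binary.PropositionalEquality.refl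
  cadj-sym G (v , suc (suc zero)) (w , suc zero)       = eqb-sym v w
  cadj-sym G (v , suc (suc zero)) (w , suc (suc zero)) = Relation.Binary.PropositionalEquality.refl

  cadj-irr : ∀ {n} (G : SimpleGraph n) x → cadj G x x ≡ false
  cadj-irr G (v , zero)           = irrefl G v
  cadj-irr G (v , suc zero)       = Relation.Binary.PropositionalEquality.refl
  cadj-irr G (v , suc (suc zero)) = Relation.Binary.PropositionalEquality.refl

corona₂ : ∀ {n} → SimpleGraph n → SimpleGraph (n * 3)
corona₂ {n} G = record
  { adj    = coronaAdj G
  ; sym    = λ i j → cadj-sym G (remQuot {n} 3 i) (remQuot {n} 3 j)
  ; irrefl = λ i → cadj-irr G (remQuot {n} 3 i)
  }

module Submission where

-- γ(M(G ∘ P₂)) = n + γ(M(G)) for every simple graph G on n vertices.  In C = G ∘ P₂ vertex v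
-- carries the path v a_v b_v, with stem v a_v and tip a_v b_v.
-- Upper bound: a dominating set of M(G), copied into M(C), together
-- with the n tips dominates M(C).
-- Lower bound: charge each element of M(C) to M(G) (v and the stem to
-- v, the copy of e to e) or privately to the path at v (a_v, b_v, the
-- tip).  The part of a dominating set S of M(C) charged to M(G)
-- dominates M(G), and as b_v is dominated only by b_v and the tip,
-- every path receives a private element: |S| ≥ n + γ(M(G)).

open import Defs hiding (sym)
open import Data.Nat using (ℕ; suc; _+_; _*_; _≤_; z≤n; s≤s)
open import Data.Nat.Properties using (≤-refl; ≤-trans; +-suc; +-comm; +-monoʳ-≤; +-monoˡ-≤; +-monoʳ-<; module ≤-Reasoning)
open import Data.Bool using (T; true; false)
open import Data.Bool.Properties using (T-irrelevant)
open import Data.Fin using (Fin; zero; suc; toℕ; combine; remQuot)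
import Data.Fin as Fin
open import Data.Fin.Patterns using (0F; 1F; 2F)
import Data.Fin.Properties as Finₚ
open import Data.Product using (Σ-syntax; _×_; _,_; proj₁; proj₂)
open import Data.Sum using (_⊎_; inj₁; inj₂; [_,_]′)
import Data.Sum as Sum
import Data.Sum.Properties as Sumₚ
open import Data.Empty using (⊥-elim)
open import Data.List using (List; []; _∷_; [_]; _++_; length; map; filter; deduplicate; concatMap; allFin)
open import Data.List.Properties using (length-removeAt′; length-++; length-map; length-tabulate)
open import Data.List.Relation.Unary.Any using (Any; here; there; index; _─_)
import Data.List.Relation.Unary.Any as Any
import Data.List.Relation.Unary.Any.Properties as Any
import Data.List.Relation.Unary.All as All
open import Data.List.Relation.Unary.AllPairs using (_∷_)
open import Data.List.Relation.Unary.Unique.Propositional using (Unique)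
import Data.List.Relation.Unary.Unique.Propositional.Properties as Uniqueₚ
open import Data.List.Relation.Unary.Unique.DecPropositional.Properties using (deduplicate-!)
open import Data.List.Membership.Propositional using (_∈_; lose; find)
open import Data.List.Membership.Propositional.Properties
  using (∈-map⁺; ∈-map⁻; ∈-++⁺ˡ; ∈-++⁺ʳ; ∈-filter⁺; ∈-filter⁻; ∈-deduplicate⁺; ∈-deduplicate⁻; ∈-concatMap⁺; ∈-allFin)
open import Data.List.Relation.Binary.Subset.Propositional using (_⊆_)
open import Data.List.Relation.Binary.Subset.Propositional.Properties using (Any-resp-⊆)
open import Data.List.Extrema.Nat using (argmin; argmin-all; f[argmin]≤v⁺)
open import Level using (0ℓ)
open import Relation.Nullary using (Dec; yes; no; does; ¬_; ¬?)
open import Relation.Nullary.Decidable using (_⊎-dec_; _×-dec_; T?)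
import Relation.Nullary.Decidable as Dec
open import Relation.Unary using (Pred; Decidable)
open import Relation.Binary using (DecidableEquality; tri<; tri≈; tri>)
import Relation.Binary as B
open import Relation.Binary.PropositionalEquality
  using (_≡_; _≢_; refl; sym; trans; cong; cong₂; subst; module ≡-Reasoning)
open import Function using (_∘_)

module _ {A : Set} where

  ∈-─ : ∀ {x z} {ys : List A} (x∈ys : x ∈ ys) → z ∈ ys → z ≢ x → z ∈ (ys ─ x∈ys)
  ∈-─ (here refl)  (here refl)  z≢x = ⊥-elim (z≢x refl)
  ∈-─ (here refl)  (there z∈ys) _   = z∈ys
  ∈-─ (there _)    (here refl)  _   = here refl
  ∈-─ (there x∈ys) (there z∈ys) z≢x = there (∈-─ x∈ys z∈ys z≢x)

  unique-⊆⇒length≤ : ∀ {xs ys : List A} → Unique xs → xs ⊆ ys → length xs ≤ length ys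
  unique-⊆⇒length≤ {[]}     _              _     = z≤n
  unique-⊆⇒length≤ {x ∷ xs} {ys} (x∉xs ∷ !xs) xs⊆ys = begin
    suc (length xs)          ≤⟨ s≤s (unique-⊆⇒length≤ !xs xs⊆ys─x) ⟩
    suc (length (ys ─ x∈ys)) ≡⟨ sym (length-removeAt′ ys (index x∈ys)) ⟩
    length ys                ∎
    where
    open ≤-Reasoning
    x∈ys : x ∈ ys
    x∈ys = xs⊆ys (here refl)
    xs⊆ys─x : xs ⊆ (ys ─ x∈ys)
    xs⊆ys─x z∈xs = ∈-─ x∈ys (xs⊆ys (there z∈xs)) (λ z≡x → All.lookup x∉xs z∈xs (sym z≡x))

  sublists : List A → List (List A)
  sublists []       = [ [] ]
  sublists (x ∷ xs) = map (x ∷_) (sublists xs) ++ sublists xs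

  filter∈sublists : ∀ {P : Pred A 0ℓ} (P? : Decidable P) xs → filter P? xs ∈ sublists xs
  filter∈sublists P? []       = here refl
  filter∈sublists P? (x ∷ xs) with does (P? x)
  ... | true  = ∈-++⁺ˡ (∈-map⁺ (x ∷_) (filter∈sublists P? xs))
  ... | false = ∈-++⁺ʳ (map (x ∷_) (sublists xs)) (filter∈sublists P? xs)

module _ {A B C : Set} (f : A → B ⊎ C) where

  lefts : List A → List B
  lefts []       = []
  lefts (x ∷ xs) with f x
  ... | inj₁ b = b ∷ lefts xs
  ... | inj₂ _ = lefts xs

  rights : List A → List C
  rights []       = []
  rights (x ∷ xs) with f x
  ... | inj₁ _ = rights xs
  ... | inj₂ c = c ∷ rights xs

  length-lefts+rights : ∀ xs → length xs ≡ length (lefts xs) + length (rights xs)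
  length-lefts+rights []       = refl
  length-lefts+rights (x ∷ xs) with f x
  ... | inj₁ _ = cong suc (length-lefts+rights xs)
  ... | inj₂ _ = trans
                   (cong suc (length-lefts+rights xs))
                   (sym (+-suc (length (lefts xs)) (length (rights xs))))

  ∈-lefts : ∀ {x b xs} → x ∈ xs → f x ≡ inj₁ b → b ∈ lefts xs
  ∈-lefts {xs = y ∷ _}  (here refl) fx≡b rewrite fx≡b = here refl
  ∈-lefts {xs = y ∷ ys} (there x∈ys) fx≡b with f y
  ... | inj₁ _ = there (∈-lefts x∈ys fx≡b)
  ... | inj₂ _ = ∈-lefts x∈ys fx≡b

  ∈-rights : ∀ {x c xs} → x ∈ xs → f x ≡ inj₂ c → c ∈ rights xs
  ∈-rights {xs = y ∷ _}  (here refl) fx≡c rewrite fx≡c = here refl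
  ∈-rights {xs = y ∷ ys} (there x∈ys) fx≡c with f y
  ... | inj₁ _ = ∈-rights x∈ys fx≡c
  ... | inj₂ _ = there (∈-rights x∈ys fx≡c)

DominatedBy : (H : Graph) → List (V H) → V H → Set
DominatedBy H S x = x ∈ S ⊎ Any (_~_ H x) S

dominated-⊆ : ∀ {H : Graph} {S T x} → S ⊆ T → DominatedBy H S x → DominatedBy H T x
dominated-⊆ S⊆T = Sum.map S⊆T (Any-resp-⊆ S⊆T)

dominated-map : ∀ {H H' : Graph} (f : V H → V H') → (∀ {x y} → _~_ H x y → _~_ H' (f x) (f y)) →
                ∀ {S x} → DominatedBy H S x → DominatedBy H' (map f S) (f x)
dominated-map f hom = Sum.map (∈-map⁺ f) (λ adjS → Any.map⁺ (Any.map hom adjS))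

-- m is the domination number of H, in the strong sense that even
-- dominating lists with repetitions have at least m entries.
record DominationNumber (H : Graph) (m : ℕ) : Set where
  field
    witness    : List (V H)
    unique     : Unique witness
    dominating : Dominating H witness
    size       : length witness ≡ m
    minimal    : ∀ S → Dominating H S → m ≤ length S

-- A finite graph with decidable equality and adjacency has a domination
-- number: every dominating list can be shrunk to a duplicate-free
-- sublist of a fixed enumeration, and among the finitely many of
-- these that dominate we take the shortest.
module FiniteDomination (H : Graph) (_≟_ : DecidableEquality (V H)) (_~?_ : B.Decidable (_~_ H))
                        (enum : List (V H)) (enum-complete : ∀ x → x ∈ enum) where

  open import Data.List.Membership.DecPropositional _≟_ using (_∈?_)

  dominating? : (S : List (V H)) → Dec (Dominating H S)
  dominating? S = Dec.map′ (λ all x → All.lookup all (enum-complete x)) (λ dom → All.tabulate (λ {x} _ → dom x))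
                    (All.all? (λ x → (x ∈? S) ⊎-dec Any.any? (x ~?_) S) enum)

  normalise : List (V H) → List (V H)
  normalise S = deduplicate _≟_ (filter (_∈? S) enum)

  ⊆-normalise : ∀ {S} → S ⊆ normalise S
  ⊆-normalise {S} x∈S = ∈-deduplicate⁺ _≟_ (∈-filter⁺ (_∈? S) (enum-complete _) x∈S)

  normalise-shorter : ∀ S → length (normalise S) ≤ length S
  normalise-shorter S = unique-⊆⇒length≤ (deduplicate-! _≟_ selected)
    (λ x∈ → proj₂ (∈-filter⁻ (_∈? S) {xs = enum} (∈-deduplicate⁻ _≟_ selected x∈)))
    where
    selected : List (V H)
    selected = filter (_∈? S) enum

  candidates : List (List (V H))
  candidates = filter dominating? (map (deduplicate _≟_) (sublists enum))

  normalise∈candidates : ∀ {S} → Dominating H S → normalise S ∈ candidates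
  normalise∈candidates {S} dom = ∈-filter⁺ dominating?
    (∈-map⁺ (deduplicate _≟_) (filter∈sublists (_∈? S) enum))
    (λ x → dominated-⊆ {H} ⊆-normalise (dom x))

  ValidCandidate : List (V H) → Set
  ValidCandidate S = Unique S × Dominating H S

  candidates-valid : ∀ {S} → S ∈ candidates → ValidCandidate S
  candidates-valid S∈ with ∈-filter⁻ dominating? {xs = map (deduplicate _≟_) (sublists enum)} S∈
  ... | S∈dedups , dom with ∈-map⁻ (deduplicate _≟_) S∈dedups
  ...   | X , _ , refl = deduplicate-! _≟_ X , dom

  shortest : List (V H)
  shortest = argmin length (normalise enum) candidates

  shortest-valid : ValidCandidate shortest
  shortest-valid = argmin-all length
    (deduplicate-! _≟_ (filter (_∈? enum) enum) , λ x → dominated-⊆ {H} ⊆-normalise (inj₁ (enum-complete x)))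
    (All.tabulate candidates-valid)

  shortest-minimal : ∀ S → Dominating H S → length shortest ≤ length S
  shortest-minimal S dom = ≤-trans
    (f[argmin]≤v⁺ {f = length} (normalise enum) candidates (inj₂ (lose (normalise∈candidates dom) ≤-refl)))
    (normalise-shorter S)

  dominationNumber : DominationNumber H (length shortest)
  dominationNumber = record
    { witness    = shortest
    ; unique     = proj₁ shortest-valid
    ; dominating = proj₂ shortest-valid
    ; size       = refl
    ; minimal    = shortest-minimal
    }

edge-≡ : ∀ {n} {G : SimpleGraph n} {u v u' v'} {p : u Fin.< v} {q : Adj G u v} {p' : u' Fin.< v'} {q' : Adj G u' v'} →
         u ≡ u' → v ≡ v' → _≡_ {A = Edge G} (u , v , p , q) (u' , v' , p' , q')
edge-≡ {p = p} {q} {p'} {q'} refl refl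
  rewrite Finₚ.<-irrelevant p p' | T-irrelevant q q' = refl

module MiddleGraph {n : ℕ} (G : SimpleGraph n) where

  _≟ₑ_ : DecidableEquality (Edge G)
  (u , v , _) ≟ₑ (u' , v' , _) =
    Dec.map′ (λ (u≡u' , v≡v') → edge-≡ {G = G} u≡u' v≡v') (λ e≡f → cong proj₁ e≡f , cong (proj₁ ∘ proj₂) e≡f)
      ((u Finₚ.≟ u') ×-dec (v Finₚ.≟ v'))

  incident? : (w : Fin n) (e : Edge G) → Dec (Incident {G = G} w e)
  incident? w (u , v , _) = (w Finₚ.≟ u) ⊎-dec (w Finₚ.≟ v)

  middleAdj? : (x y : Fin n ⊎ Edge G) → Dec (MiddleAdj G x y)
  middleAdj? (inj₁ _) (inj₁ _) = no λ ()
  middleAdj? (inj₁ w) (inj₂ e) = incident? w e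
  middleAdj? (inj₂ e) (inj₁ w) = incident? w e
  middleAdj? (inj₂ e) (inj₂ f) =
    ¬? (e ≟ₑ f) ×-dec Finₚ.any? (λ w → incident? w e ×-dec incident? w f)

  edgesBetween : (u v : Fin n) → List (Edge G)
  edgesBetween u v with u Finₚ.<? v | T? (adj G u v)
  ... | yes u<v | yes uv = [ (u , v , u<v , uv) ]
  ... | _       | _      = []

  ∈-edgesBetween : ∀ u v (u<v : u Fin.< v) (uv : Adj G u v) → (u , v , u<v , uv) ∈ edgesBetween u v
  ∈-edgesBetween u v u<v uv with u Finₚ.<? v | T? (adj G u v)
  ... | yes _ | yes _  = here (edge-≡ {G = G} refl refl)
  ... | no ¬p | _      = ⊥-elim (¬p u<v)
  ... | yes _ | no ¬uv = ⊥-elim (¬uv uv)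

  edges : List (Edge G)
  edges = concatMap (λ u → concatMap (edgesBetween u) (allFin n)) (allFin n)

  ∈-edges : ∀ e → e ∈ edges
  ∈-edges (u , v , u<v , uv) =
    ∈-concatMap⁺ (λ u → concatMap (edgesBetween u) (allFin n))
      (lose (∈-allFin u) (∈-concatMap⁺ (edgesBetween u) (lose (∈-allFin v) (∈-edgesBetween u v u<v uv))))

  middleElements : List (Fin n ⊎ Edge G)
  middleElements = map inj₁ (allFin n) ++ map inj₂ edges

  ∈-middleElements : ∀ x → x ∈ middleElements
  ∈-middleElements (inj₁ v) = ∈-++⁺ˡ (∈-map⁺ inj₁ (∈-allFin v))
  ∈-middleElements (inj₂ e) = ∈-++⁺ʳ (map inj₁ (allFin n)) (∈-map⁺ inj₂ (∈-edges e))

  middleDomination : Σ[ m ∈ ℕ ] DominationNumber (M G) m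
  middleDomination = _ , dominationNumber
    where open FiniteDomination (M G) (Sumₚ.≡-dec Finₚ._≟_ _≟ₑ_) middleAdj? middleElements ∈-middleElements

T-does⇒ : ∀ {A : Set} (d : Dec A) → T (does d) → A
T-does⇒ (yes a) _ = a

T-does⇐ : ∀ {A : Set} (d : Dec A) → A → T (does d)
T-does⇐ (yes _) _ = _
T-does⇐ (no ¬a) a = ¬a a

module Corona {n : ℕ} (G : SimpleGraph n) where

  C : SimpleGraph (n * 3)
  C = corona₂ G

  -- node v 0F is v itself, node v 1F is a_v and node v 2F is b_v.
  node : Fin n → Fin 3 → Fin (n * 3)
  node = combine

  node-injective : ∀ {v t w s} → node v t ≡ node w s → v ≡ w × t ≡ s
  node-injective {v} {t} {w} {s} = Finₚ.combine-injective v t w s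

  node-level-≢ : ∀ {v t w s} → t ≢ s → node v t ≢ node w s
  node-level-≢ t≢s = t≢s ∘ proj₂ ∘ node-injective

  node-<ʳ : ∀ v {t s} → t Fin.< s → node v t Fin.< node v s
  node-<ʳ v {t} {s} t<s rewrite Finₚ.toℕ-combine v t | Finₚ.toℕ-combine v s = +-monoʳ-< (3 * toℕ v) t<s

  node-<ˡ⁻¹ : ∀ {u w} → node u 0F Fin.< node w 0F → u Fin.< w
  node-<ˡ⁻¹ {u} {w} lt with Finₚ.<-cmp u w
  ... | tri< u<w _ _ = u<w
  ... | tri≈ _ refl _ = ⊥-elim (Finₚ.<-irrefl refl lt)
  ... | tri> _ _ w<u = ⊥-elim (Finₚ.<-asym lt (Finₚ.combine-monoˡ-< 0F 0F w<u))

  data CoronaAdj : Fin n → Fin 3 → Fin n → Fin 3 → Set where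
    base   : ∀ {v w} → Adj G v w → CoronaAdj v 0F w 0F
    stem   : ∀ {v} → CoronaAdj v 0F v 1F
    stem⁻¹ : ∀ {v} → CoronaAdj v 1F v 0F
    tip    : ∀ {v} → CoronaAdj v 1F v 2F
    tip⁻¹  : ∀ {v} → CoronaAdj v 2F v 1F

  decode : ∀ {v t w s} → Adj C (node v t) (node w s) → CoronaAdj v t w s
  decode {v} {t} {w} {s} vt~ws
    rewrite Finₚ.remQuot-combine {n} {3} v t | Finₚ.remQuot-combine {n} {3} w s with t | s
  ... | 0F | 0F = base vt~ws
  ... | 0F | 1F with refl ← T-does⇒ (v Finₚ.≟ w) vt~ws = stem
  ... | 1F | 0F with refl ← T-does⇒ (v Finₚ.≟ w) vt~ws = stem⁻¹
  ... | 1F | 2F with refl ← T-does⇒ (v Finₚ.≟ w) vt~ws = tip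
  ... | 2F | 1F with refl ← T-does⇒ (v Finₚ.≟ w) vt~ws = tip⁻¹

  encode : ∀ {v t w s} → CoronaAdj v t w s → Adj C (node v t) (node w s)
  encode {v} {t} {w} {s} a
    rewrite Finₚ.remQuot-combine {n} {3} v t | Finₚ.remQuot-combine {n} {3} w s with a
  ... | base v~w = v~w
  ... | stem     = T-does⇐ (v Finₚ.≟ v) refl
  ... | stem⁻¹   = T-does⇐ (v Finₚ.≟ v) refl
  ... | tip      = T-does⇐ (v Finₚ.≟ v) refl
  ... | tip⁻¹    = T-does⇐ (v Finₚ.≟ v) refl

  baseEdge : Edge G → Edge C
  baseEdge (u , w , u<w , u~w) = node u 0F , node w 0F , Finₚ.combine-monoˡ-< 0F 0F u<w , encode (base u~w)

  stemEdge : Fin n → Edge C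
  stemEdge v = node v 0F , node v 1F , node-<ʳ v (s≤s z≤n) , encode stem

  tipEdge : Fin n → Edge C
  tipEdge v = node v 1F , node v 2F , node-<ʳ v (s≤s (s≤s z≤n)) , encode tip

  data CoronaEdge : Edge C → Set where
    base : (e : Edge G) → CoronaEdge (baseEdge e)
    stem : (v : Fin n) → CoronaEdge (stemEdge v)
    tip  : (v : Fin n) → CoronaEdge (tipEdge v)

  classify : ∀ {v t w s} (lt : node v t Fin.< node w s) (a : Adj C (node v t) (node w s)) →
             CoronaAdj v t w s → CoronaEdge (node v t , node w s , lt , a)
  classify {v} {w = w} lt a (base v~w) = subst CoronaEdge (edge-≡ {G = C} refl refl) (base (v , w , node-<ˡ⁻¹ lt , v~w))
  classify {v} lt a stem   = subst CoronaEdge (edge-≡ {G = C} refl refl) (stem v)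
  classify {v} lt a tip    = subst CoronaEdge (edge-≡ {G = C} refl refl) (tip v)
  classify {v} lt a stem⁻¹ = ⊥-elim (Finₚ.<-asym lt (node-<ʳ v (s≤s z≤n)))
  classify {v} lt a tip⁻¹  = ⊥-elim (Finₚ.<-asym lt (node-<ʳ v (s≤s (s≤s z≤n))))

  coronaEdge : (y : Edge C) → CoronaEdge y
  coronaEdge (i , j , i<j , i~j) with Finₚ.combine-surjective {n} {3} i | Finₚ.combine-surjective {n} {3} j
  ... | _ , _ , refl | _ , _ , refl = classify i<j i~j (decode i~j)

  data EdgeAtBase (x : Fin n) : Edge C → Set where
    base : ∀ e → Incident {G = G} x e → EdgeAtBase x (baseEdge e)
    stem : EdgeAtBase x (stemEdge x)

  edgeAtBase : ∀ {x y} → Incident {G = C} (node x 0F) y → EdgeAtBase x y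
  edgeAtBase {y = y} x∈y with coronaEdge y
  ... | base e@(_ , _ , _) = base e (Sum.map (proj₁ ∘ node-injective) (proj₁ ∘ node-injective) x∈y)
  ... | stem v with x∈y
  ...   | inj₁ x≡v with refl ← proj₁ (node-injective x≡v) = stem
  ...   | inj₂ x≡a_v = ⊥-elim (node-level-≢ (λ ()) x≡a_v)
  edgeAtBase x∈y | tip v = ⊥-elim ([ node-level-≢ (λ ()) , node-level-≢ (λ ()) ]′ x∈y)

  edgeAtLeaf : ∀ {x y} → Incident {G = C} (node x 2F) y → y ≡ tipEdge x
  edgeAtLeaf {y = y} x∈y with coronaEdge y
  ... | base (_ , _ , _) = ⊥-elim ([ node-level-≢ (λ ()) , node-level-≢ (λ ()) ]′ x∈y)
  ... | stem v = ⊥-elim ([ node-level-≢ (λ ()) , node-level-≢ (λ ()) ]′ x∈y)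
  ... | tip v with x∈y
  ...   | inj₁ b_x≡a_v = ⊥-elim (node-level-≢ (λ ()) b_x≡a_v)
  ...   | inj₂ x≡v with refl ← proj₁ (node-injective x≡v) = refl

  -- Charging the elements of M(C): a base node v and a copy of a G-edge
  -- e are charged to v and e in M(G), the stem v a_v is charged to v,
  -- while a_v, b_v and the tip a_v b_v are private to the path at v.
  Charge : Set
  Charge = (Fin n ⊎ Edge G) ⊎ Fin n

  chargeNode : Fin n × Fin 3 → Charge
  chargeNode (v , zero)  = inj₁ (inj₁ v)
  chargeNode (v , suc _) = inj₂ v

  chargeEdge : ∀ {y} → CoronaEdge y → Charge
  chargeEdge (base e) = inj₁ (inj₂ e)
  chargeEdge (stem v) = inj₁ (inj₁ v)
  chargeEdge (tip v)  = inj₂ v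

  charge : Fin (n * 3) ⊎ Edge C → Charge
  charge (inj₁ i) = chargeNode (remQuot 3 i)
  charge (inj₂ y) = chargeEdge (coronaEdge y)

  charge-node : ∀ v t → charge (inj₁ (node v t)) ≡ chargeNode (v , t)
  charge-node v t = cong chargeNode (Finₚ.remQuot-combine v t)

  chargeEdge-unique : ∀ {y y'} (d : CoronaEdge y) (d' : CoronaEdge y') → y ≡ y' → chargeEdge d ≡ chargeEdge d'
  chargeEdge-unique (base (_ , _ , _)) (base (_ , _ , _)) y≡y' =
    cong (inj₁ ∘ inj₂) (edge-≡ {G = G} (proj₁ (node-injective (cong proj₁ y≡y')))
                               (proj₁ (node-injective (cong (proj₁ ∘ proj₂) y≡y'))))
  chargeEdge-unique (stem _) (stem _) y≡y' = cong (inj₁ ∘ inj₁) (proj₁ (node-injective (cong proj₁ y≡y')))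
  chargeEdge-unique (tip _)  (tip _)  y≡y' = cong inj₂ (proj₁ (node-injective (cong proj₁ y≡y')))
  chargeEdge-unique (base (_ , _ , _)) (stem _) y≡y' = ⊥-elim (node-level-≢ (λ ()) (cong (proj₁ ∘ proj₂) y≡y'))
  chargeEdge-unique (base (_ , _ , _)) (tip _)  y≡y' = ⊥-elim (node-level-≢ (λ ()) (cong proj₁ y≡y'))
  chargeEdge-unique (stem _) (base (_ , _ , _)) y≡y' = ⊥-elim (node-level-≢ (λ ()) (cong (proj₁ ∘ proj₂) y≡y'))
  chargeEdge-unique (stem _) (tip _)  y≡y' = ⊥-elim (node-level-≢ (λ ()) (cong proj₁ y≡y'))
  chargeEdge-unique (tip _)  (base (_ , _ , _)) y≡y' = ⊥-elim (node-level-≢ (λ ()) (cong proj₁ y≡y'))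
  chargeEdge-unique (tip _)  (stem _) y≡y' = ⊥-elim (node-level-≢ (λ ()) (cong proj₁ y≡y'))

  charge-edge : ∀ {y} (d : CoronaEdge y) → charge (inj₂ y) ≡ chargeEdge d
  charge-edge d = chargeEdge-unique (coronaEdge _) d refl

  -- M(G) sits inside M(C) on the base nodes and the copies of G-edges;
  -- charging undoes this embedding.
  embed : Fin n ⊎ Edge G → Fin (n * 3) ⊎ Edge C
  embed (inj₁ v) = inj₁ (node v 0F)
  embed (inj₂ e) = inj₂ (baseEdge e)

  charge-embed : ∀ x → charge (embed x) ≡ inj₁ x
  charge-embed (inj₁ v) = charge-node v 0F
  charge-embed (inj₂ e) = charge-edge (base e)

  embed-injective : ∀ {x y} → embed x ≡ embed y → x ≡ y
  embed-injective {x} {y} eq = Sumₚ.inj₁-injective (begin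
    inj₁ x           ≡⟨ sym (charge-embed x) ⟩
    charge (embed x) ≡⟨ cong charge eq ⟩
    charge (embed y) ≡⟨ charge-embed y ⟩
    inj₁ y           ∎)
    where open ≡-Reasoning

  incident-base : ∀ {w e} → Incident {G = G} w e → Incident {G = C} (node w 0F) (baseEdge e)
  incident-base {e = _ , _ , _} = Sum.map (cong (λ u → node u 0F)) (cong (λ u → node u 0F))

  embed-adj : ∀ {x y} → MiddleAdj G x y → MiddleAdj C (embed x) (embed y)
  embed-adj {inj₁ _} {inj₂ e} w∈e = incident-base {e = e} w∈e
  embed-adj {inj₂ e} {inj₁ _} w∈e = incident-base {e = e} w∈e
  embed-adj {inj₂ e} {inj₂ f} (e≢f , w , w∈e , w∈f) =
    (e≢f ∘ Sumₚ.inj₂-injective ∘ embed-injective ∘ cong inj₂) ,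
    node w 0F , incident-base {e = e} w∈e , incident-base {e = f} w∈f

  charge-tip : ∀ v → charge (inj₂ (tipEdge v)) ≡ inj₂ v
  charge-tip v = charge-edge (tip v)

  tips : List (Fin (n * 3) ⊎ Edge C)
  tips = map (inj₂ ∘ tipEdge) (allFin n)

  module Upper {D : List (Fin n ⊎ Edge G)} (D-dom : Dominating (M G) D) where

    S : List (Fin (n * 3) ⊎ Edge C)
    S = tips ++ map embed D

    -- a_v, b_v, the stem and the tip at v are all next to or equal to the tip.
    near-tip : ∀ v {x} → MiddleAdj C x (inj₂ (tipEdge v)) → DominatedBy (M C) S x
    near-tip v x~tip = inj₂ (lose (∈-++⁺ˡ (∈-map⁺ (inj₂ ∘ tipEdge) (∈-allFin v))) x~tip)

    embedded : ∀ x → DominatedBy (M C) S (embed x)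
    embedded x = dominated-⊆ {M C} (∈-++⁺ʳ tips) (dominated-map {M G} {M C} embed embed-adj (D-dom x))

    dominating : Dominating (M C) S
    dominating (inj₁ i) with Finₚ.combine-surjective {n} {3} i
    ... | v , 0F , refl = embedded (inj₁ v)
    ... | v , 1F , refl = near-tip v (inj₁ refl)
    ... | v , 2F , refl = near-tip v (inj₂ refl)
    dominating (inj₂ y) with coronaEdge y
    ... | base e = embedded (inj₂ e)
    ... | stem v = near-tip v ((node-level-≢ (λ ()) ∘ cong proj₁) , node v 1F , inj₂ refl , inj₁ refl)
    ... | tip v  = inj₁ (∈-++⁺ˡ (∈-map⁺ (inj₂ ∘ tipEdge) (∈-allFin v)))

    unique : Unique D → Unique S
    unique D-unique =
      Uniqueₚ.++⁺ (Uniqueₚ.map⁺ tip-injective (Uniqueₚ.allFin⁺ n)) (Uniqueₚ.map⁺ embed-injective D-unique) disjoint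
      where
      tip-injective : ∀ {v w} → inj₂ (tipEdge v) ≡ inj₂ (tipEdge w) → v ≡ w
      tip-injective {v} {w} eq = Sumₚ.inj₂-injective (trans (sym (charge-tip v)) (trans (cong charge eq) (charge-tip w)))
      disjoint : ∀ {x} → ¬ (x ∈ tips × x ∈ map embed D)
      disjoint (x∈tips , x∈D) with ∈-map⁻ (inj₂ ∘ tipEdge) x∈tips | ∈-map⁻ embed x∈D
      ... | v , _ , refl | z , _ , eq with trans (sym (charge-tip v)) (trans (cong charge eq) (charge-embed z))
      ... | ()

    size : length S ≡ n + length D
    size = begin
      length S                           ≡⟨ length-++ tips ⟩
      length tips + length (map embed D) ≡⟨ cong₂ _+_ (trans (length-map _ (allFin n)) (length-tabulate (λ i → i)))
                                                      (length-map embed D) ⟩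
      n + length D                       ∎
      where open ≡-Reasoning

  module Lower {S : List (Fin (n * 3) ⊎ Edge C)} (S-dom : Dominating (M C) S) where

    L : List (Fin n ⊎ Edge G)
    L = lefts charge S

    P : List (Fin n)
    P = rights charge S

    inL : ∀ {x z} → x ∈ S → charge x ≡ inj₁ z → z ∈ L
    inL = ∈-lefts charge

    beside-node : ∀ {e x} → Incident {G = G} x e → inj₁ (node x 0F) ∈ S → Any (MiddleAdj G (inj₂ e)) L
    beside-node {x = x} x∈e x∈S = lose (inL x∈S (charge-node x 0F)) x∈e

    beside-edge : ∀ {e x y} → Incident {G = G} x e → inj₂ y ∈ S → baseEdge e ≢ y →
                  Incident {G = C} (node x 0F) y → Any (MiddleAdj G (inj₂ e)) L
    beside-edge {x = x} {y} x∈e y∈S e≢y x∈y with edgeAtBase {x} {y} x∈y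
    ... | base e' x∈e' = lose (inL y∈S (charge-edge (base e'))) ((e≢y ∘ cong baseEdge) , _ , x∈e , x∈e')
    ... | stem         = lose (inL y∈S (charge-edge (stem _))) x∈e

    dominating : Dominating (M G) L
    dominating (inj₁ v) with S-dom (inj₁ (node v 0F))
    ... | inj₁ v∈S = inj₁ (inL v∈S (charge-node v 0F))
    ... | inj₂ v~S with find v~S
    ...   | inj₁ _ , _ , ()
    ...   | inj₂ y , y∈S , v∈y with edgeAtBase {v} {y} v∈y
    ...     | base e v∈e = inj₂ (lose (inL y∈S (charge-edge (base e))) v∈e)
    ...     | stem       = inj₁ (inL y∈S (charge-edge (stem v)))
    dominating (inj₂ e@(u , w , _)) with S-dom (inj₂ (baseEdge e))
    ... | inj₁ e∈S = inj₁ (inL e∈S (charge-embed (inj₂ e)))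
    ... | inj₂ e~S with find e~S
    ...   | inj₁ _ , u∈S , inj₁ refl = inj₂ (beside-node {e = e} (inj₁ refl) u∈S)
    ...   | inj₁ _ , w∈S , inj₂ refl = inj₂ (beside-node {e = e} (inj₂ refl) w∈S)
    ...   | inj₂ y , y∈S , (e≢y , _ , inj₁ refl , u∈y) = inj₂ (beside-edge {e = e} (inj₁ refl) y∈S e≢y u∈y)
    ...   | inj₂ y , y∈S , (e≢y , _ , inj₂ refl , w∈y) = inj₂ (beside-edge {e = e} (inj₂ refl) y∈S e≢y w∈y)

    -- b_v is dominated only by itself and the tip a_v b_v, both private to v.
    private-to : ∀ v → v ∈ P
    private-to v with S-dom (inj₁ (node v 2F))
    ... | inj₁ b∈S = ∈-rights charge b∈S (charge-node v 2F)
    ... | inj₂ b~S with find b~S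
    ...   | inj₁ _ , _ , ()
    ...   | inj₂ y , y∈S , b∈y with refl ← edgeAtLeaf {v} {y} b∈y = ∈-rights charge y∈S (charge-tip v)

    size : n + length L ≤ length S
    size = begin
      n + length L                 ≡⟨ cong (_+ length L) (sym (length-tabulate (λ i → i))) ⟩
      length (allFin n) + length L ≤⟨ +-monoˡ-≤ (length L) private-count ⟩
      length P + length L          ≡⟨ +-comm (length P) (length L) ⟩
      length L + length P          ≡⟨ sym (length-lefts+rights charge S) ⟩
      length S                     ∎
      where
      open ≤-Reasoning
      private-count : length (allFin n) ≤ length P
      private-count = unique-⊆⇒length≤ (Uniqueₚ.allFin⁺ n) (λ {v} _ → private-to v)

  corona-upper : ∀ {m} → DominationNumber (M G) m →
                 Σ[ S ∈ List (Fin (n * 3) ⊎ Edge C) ] (Unique S × Dominating (M C) S × length S ≡ n + m)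
  corona-upper γ = S , unique γ-unique , dominating , trans size (cong (n +_) γ-size)
    where
    open DominationNumber γ using () renaming (unique to γ-unique; size to γ-size; dominating to γ-dominating)
    open Upper γ-dominating

  corona-lower : ∀ {m} → DominationNumber (M G) m → ∀ S → Dominating (M C) S → n + m ≤ length S
  corona-lower γ S S-dom = ≤-trans (+-monoʳ-≤ n (minimal L dominating)) size
    where
    open DominationNumber γ using (minimal)
    open Lower S-dom

isDominationNumber : ∀ {H m} → DominationNumber H m → IsDominationNumber H m
isDominationNumber γ = (witness , unique , dominating , size) , λ S _ → minimal S
  where open DominationNumber γ

theorem2p13 : (n : ℕ) → 2 ≤ n → (G : SimpleGraph n) → Connected G →
    Σ[ m ∈ ℕ ] (IsDominationNumber (M G) m × IsDominationNumber (M (corona₂ G)) (n + m))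
theorem2p13 n _ G _ = m , isDominationNumber γ , corona-upper γ , λ S _ → corona-lower γ S
  where
  open MiddleGraph G using (middleDomination)
  open Corona G using (corona-upper; corona-lower)
  m : ℕ
  m = proj₁ middleDomination
  γ : DominationNumber (M G) m
  γ = proj₂ middleDomination
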